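{- Let $S$ be a semigroup with $S=I_1\cup I_2$, where $I_1$ and $I_2$ are minimal left ideals of $S$. Then $I_1$ and $I_2$ are maximal left ideals of $S$.
   Context: A left ideal of a semigroup $S$ is a non-empty subset $I$ with $SI\subseteq I$; it is nontrivial if $I\neq S$, minimal if it properly contains no left ideal of $S$, and (when nontrivial) maximal if it is not properly contained in any nontrivial left ideal of $S$. -}

module Defs where

open import Level using (Level; _⊔_; suc)
open import Algebra.Bundles using (Semigroup)
open import Data.Product using (Σ; _×_; ∃)
open import Data.Sum using (_⊎_)
open import Relation.Nullary using (¬_)

module _ {c ℓ : Level} (S : Semigroup c ℓ) where
  open Semigroup S

  Subset : (p : Level) → Set (c ⊔ suc p)
  Subset p = Carrier → Set p

  _⊆_ : {p q : Level} → Subset p → Subset q → Set (c ⊔ p ⊔ q)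
  A ⊆ B = ∀ x → A x → B x

  _≐_ : {p q : Level} → Subset p → Subset q → Set (c ⊔ p ⊔ q)
  A ≐ B = (A ⊆ B) × (B ⊆ A)

  Whole : Subset ℓ
  Whole x = x ≈ x

  _∪_ : {p : Level} → Subset p → Subset p → Subset p
  (A ∪ B) x = A x ⊎ B x

  record IsLeftIdeal {p : Level} (I : Subset p) : Set (c ⊔ ℓ ⊔ p) where
    field
      respects : ∀ {x y} → x ≈ y → I x → I y
      nonEmpty : ∃ I
      leftClosed : ∀ s x → I x → I (s ∙ x)

  Nontrivial : {p : Level} → Subset p → Set (c ⊔ ℓ ⊔ p)
  Nontrivial I = ¬ (Whole ⊆ I)

  IsMinimalLeftIdeal : {p : Level} → Subset p → Set (c ⊔ ℓ ⊔ suc p)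
  IsMinimalLeftIdeal {p} I = IsLeftIdeal I ×
    (∀ (J : Subset p) → IsLeftIdeal J → J ⊆ I → I ⊆ J)

  IsMaximalLeftIdeal : {p : Level} → Subset p → Set (c ⊔ ℓ ⊔ suc p)
  IsMaximalLeftIdeal {p} I = IsLeftIdeal I × Nontrivial I ×
    (∀ (J : Subset p) → IsLeftIdeal J → Nontrivial J → I ⊆ J → J ⊆ I)

-- A left ideal meeting a minimal left ideal I cuts out of I a left ideal, hence contains I.
-- So a nontrivial left ideal J ⊇ I₁ cannot meet I₂ (otherwise J ⊇ I₁ ∪ I₂ = S), and
-- since S = I₁ ∪ I₂ this forces J ⊆ I₁. Likewise I₁ = S would give I₁ ⊇ I₂, and
-- minimality of I₁ would then make I₁ and I₂ equal.
module Submission where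

open import Defs
open import Level using (Level; _⊔_)
open import Algebra.Bundles using (Semigroup)
open import Data.Product using (_×_; _,_; ∃; proj₁; proj₂) renaming (swap to ×-swap)
open import Data.Sum using (inj₁; inj₂; [_,_]) renaming (swap to ⊎-swap)
open import Data.Empty using (⊥-elim)
open import Relation.Nullary using (¬_)

module _ {c ℓ : Level} (S : Semigroup c ℓ) where
  open Semigroup S

  _∩_ : {p : Level} → Subset S p → Subset S p → Subset S p
  (A ∩ B) x = A x × B x

  Meets : {p : Level} → Subset S p → Subset S p → Set (c ⊔ p)
  Meets A B = ∃ (A ∩ B)

  ∩-isLeftIdeal : {p : Level} {I J : Subset S p} →
                  IsLeftIdeal S I → IsLeftIdeal S J → Meets I J → IsLeftIdeal S (I ∩ J)
  ∩-isLeftIdeal LI LJ meet = record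
    { respects   = λ x≈y (ix , jx) → respects LI x≈y ix , respects LJ x≈y jx
    ; nonEmpty   = meet
    ; leftClosed = λ s x (ix , jx) → leftClosed LI s x ix , leftClosed LJ s x jx
    }
    where open IsLeftIdeal

  minimal⊆meeting : {p : Level} {I J : Subset S p} →
                    IsMinimalLeftIdeal S I → IsLeftIdeal S J → Meets J I → _⊆_ S I J
  minimal⊆meeting (LI , minI) LJ meet x ix =
    proj₁ (minI _ (∩-isLeftIdeal LJ LI meet) (λ _ → proj₂) x ix)

  maximal-of-cover : {p : Level} {I₁ I₂ : Subset S p} →
                     IsMinimalLeftIdeal S I₁ → IsMinimalLeftIdeal S I₂ →
                     ¬ (_≐_ S I₁ I₂) → _⊆_ S (Whole S) (_∪_ S I₁ I₂) →
                     IsMaximalLeftIdeal S I₁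
  maximal-of-cover {I₁ = I₁} {I₂} m₁ m₂ I₁≉I₂ cover = proj₁ m₁ , nontrivial , maximal
    where
    nontrivial : Nontrivial S I₁
    nontrivial whole⊆I₁ with IsLeftIdeal.nonEmpty (proj₁ m₂)
    ... | x , i₂x = I₁≉I₂ (minimal⊆meeting m₁ (proj₁ m₂) (x , i₂x , whole⊆I₁ x refl) , I₂⊆I₁)
      where
      I₂⊆I₁ : _⊆_ S I₂ I₁
      I₂⊆I₁ y _ = whole⊆I₁ y refl

    maximal : ∀ J → IsLeftIdeal S J → Nontrivial S J → _⊆_ S I₁ J → _⊆_ S J I₁
    maximal J LJ ntJ I₁⊆J x jx with cover x refl
    ... | inj₁ i₁x = i₁x
    ... | inj₂ i₂x = ⊥-elim (ntJ λ y y≈y → [ I₁⊆J y , I₂⊆J y ] (cover y y≈y))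
      where
      I₂⊆J : _⊆_ S I₂ J
      I₂⊆J = minimal⊆meeting m₂ LJ (x , jx , i₂x)

mainTheorem17 : {c ℓ p : Level} (S : Semigroup c ℓ) (I₁ I₂ : Subset S p) →
    IsMinimalLeftIdeal S I₁ → IsMinimalLeftIdeal S I₂ →
    ¬ (_≐_ S I₁ I₂) →
    _⊆_ S (Whole S) (_∪_ S I₁ I₂) →
    IsMaximalLeftIdeal S I₁ × IsMaximalLeftIdeal S I₂
mainTheorem17 S I₁ I₂ m₁ m₂ I₁≉I₂ cover =
  maximal-of-cover S m₁ m₂ I₁≉I₂ cover ,
  maximal-of-cover S m₂ m₁ (λ I₂≐I₁ → I₁≉I₂ (×-swap I₂≐I₁)) (λ x x≈x → ⊎-swap (cover x x≈x))
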